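{- Let $G$ be a connected graph with at least two vertices, with vertex set $\{1,\dots,n\}$, $m$ edges, $\tau$ spanning trees, degree vector $d\in\mathbb{R}^n$ and $2$-forest matrix $S$. Then for every $v\in V(G)$, $$\lambda_v(G):=-3d^TSd+12m\,d^TSe_v+8m^2\tau+4m\tau-12\tau>0,$$ where $e_v\in\mathbb{R}^n$ is the $v$-th standard unit vector.
   Context: All graphs are finite, simple, undirected and unweighted. The $2$-forest matrix of $G$ is the symmetric $n\times n$ matrix $S=[s_{ij}]$ where $s_{ij}$ is the number of spanning forests of $G$ consisting of exactly two trees $T_1,T_2$ with $i\in V(T_1)$ and $j\in V(T_2)$ (so $s_{ii}=0$). -}

module Defs where

open import Data.Bool using (Bool; true; false; _∧_; _∨_; not; if_then_else_; T)
open import Data.Nat using (ℕ; zero; suc; _<_; _≤_)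
open import Data.Fin using (Fin; toℕ; _≟_)
open import Data.Product using (_×_; _,_)
open import Data.List using (List; []; _∷_; _++_; map; length; allFin; concatMap; [_])
open import Data.Bool.ListAction using (any; all)
open import Data.Nat.ListAction using (sum)
open import Relation.Nullary.Decidable using (⌊_⌋)
open import Relation.Binary.PropositionalEquality using (_≡_)
open import Data.Integer using (ℤ; +_)

record Graph (n : ℕ) : Set where
  field
    adj   : Fin n → Fin n → Bool
    sym   : ∀ i j → adj i j ≡ adj j i
    irrefl : ∀ i → adj i i ≡ false
open Graph public

Edge : ℕ → Set
Edge n = Fin n × Fin n

edges : ∀ {n} → Graph n → List (Edge n)
edges {n} G = concatMap (λ i → concatMap (λ j →
  if ⌊ toℕ i Data.Nat.<? toℕ j ⌋ ∧ adj G i j then [ (i , j) ] else []) (allFin n)) (allFin n)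

numEdges : ∀ {n} → Graph n → ℕ
numEdges G = length (edges G)

deg : ∀ {n} → Graph n → Fin n → ℕ
deg {n} G i = length (Data.List.filterᵇ (adj G i) (allFin n))

sublists : ∀ {A : Set} → List A → List (List A)
sublists [] = [] ∷ []
sublists (x ∷ xs) = sublists xs ++ map (x ∷_) (sublists xs)

reach : ∀ {n} → List (Edge n) → ℕ → Fin n → Fin n → Bool
reach F zero i j = ⌊ i ≟ j ⌋
reach F (suc k) i j = ⌊ i ≟ j ⌋ ∨ any step F
  where
  step : _ → Bool
  step (a , b) = (⌊ a ≟ i ⌋ ∧ reach F k b j) ∨ (⌊ b ≟ i ⌋ ∧ reach F k a j)

-- i and j lie in the same component of the spanning subgraph (Fin n, F)
-- (walks of length ≤ n suffice on n vertices)
connIn : ∀ {n} → List (Edge n) → Fin n → Fin n → Bool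
connIn {n} F i j = reach F n i j

-- F is acyclic: every edge of F is a bridge, i.e. its endpoints are
-- disconnected once that edge is removed.
acyclicAux : ∀ {n} → List (Edge n) → List (Edge n) → Bool
acyclicAux pre [] = true
acyclicAux pre ((a , b) ∷ post) =
  not (connIn (pre ++ post) a b) ∧ acyclicAux (pre ++ [ (a , b) ]) post

acyclic : ∀ {n} → List (Edge n) → Bool
acyclic F = acyclicAux [] F

isSpanningTree : ∀ {n} → List (Edge n) → Bool
isSpanningTree {n} F =
  acyclic F ∧ all (λ i → all (λ j → connIn F i j) (allFin n)) (allFin n)

isTwoForestSep : ∀ {n} → List (Edge n) → Fin n → Fin n → Bool
isTwoForestSep {n} F i j =
  acyclic F ∧ not (connIn F i j) ∧ all (λ k → connIn F i k ∨ connIn F j k) (allFin n)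

countB : ∀ {A : Set} → (A → Bool) → List A → ℕ
countB p xs = length (Data.List.filterᵇ p xs)

numSpanningTrees : ∀ {n} → Graph n → ℕ
numSpanningTrees G = countB isSpanningTree (sublists (edges G))

twoForest : ∀ {n} → Graph n → Fin n → Fin n → ℕ
twoForest G i j = countB (λ F → isTwoForestSep F i j) (sublists (edges G))

Connected : ∀ {n} → Graph n → Set
Connected {n} G = ∀ i j → T (connIn (edges G) i j)

dSd : ∀ {n} → Graph n → ℕ
dSd {n} G = sum (map (λ i → sum (map (λ j → deg G i Data.Nat.* twoForest G i j Data.Nat.* deg G j) (allFin n))) (allFin n))

dSe : ∀ {n} → Graph n → Fin n → ℕ
dSe {n} G v = sum (map (λ i → deg G i Data.Nat.* twoForest G i v) (allFin n))

lambdaV : ∀ {n} → Graph n → Fin n → ℤ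
lambdaV G v =
  let open Data.Integer using (_+_; _*_; _-_; -_)
      m = + numEdges G
      τ = + numSpanningTrees G
  in (- (+ 3 * + dSd G)) + + 12 * m * + dSe G v + + 8 * m * m * τ + + 4 * m * τ - + 12 * τ

module Submission where

-- A 2-forest separating i from j separates v from i or from j, so the 2-forest
-- matrix satisfies s i j ≤ s i v + s j v and s i i = 0.  Hence
-- dᵀSd ≤ Σ i j, d i d j (s i v + s j v) = 2 (dᵀSe_v) (Σ d) = 4 m dᵀSe_v, strictly as
-- soon as some u with d u > 0 has s u v > 0, because the diagonal term at u is 0 on
-- the left.  Such a u exists: deleting the last edge that a greedy spanning-tree
-- construction adds leaves a 2-forest separating the endpoints of an edge, and it
-- separates v from one of them.  So 3 dᵀSd < 12 m dᵀSe_v, and 12 τ ≤ 8 m² τ + 4 m τ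
-- as m ≥ 1.

open import Defs hiding (sym)
open import Data.Bool using (Bool; true; false; T; not; _∧_; _∨_; if_then_else_)
open import Data.Bool.Properties using (T-∧; T-∨)
open import Data.Empty using (⊥-elim)
open import Data.Fin using (Fin; zero; suc)
open import Data.List using (List; []; _∷_; _++_; [_]; map; length; allFin)
open import Data.List.Membership.Propositional using (_∈_)
open import Data.List.Membership.Propositional.Properties using (∈-allFin)
open import Data.List.Relation.Unary.Any using (here; there)
open import Data.Nat using (ℕ; zero; suc; _≤_; z≤n; s≤s)
open import Data.Nat.ListAction using (sum)
open import Data.Product using (∃-syntax; _×_; _,_)
open import Data.Sum using (_⊎_; inj₁; inj₂)
open import Function using (_∘_)
open import Function.Bundles using (module Equivalence)
open import Relation.Binary.PropositionalEquality hiding ([_])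
open import Relation.Nullary using (¬_; yes; no)
open Equivalence using (to; from)

module Sums where

  open import Data.List.Membership.Propositional using (lose)
  open import Data.List.Properties using (length-filter; filter-some; filter-none)
  open import Data.List.Relation.Unary.All as All using ()
  open import Data.Nat using (_+_; _*_; _<_)
  open import Data.Nat.Properties
    using (+-mono-≤; +-mono-<-≤; +-mono-≤-<; *-zeroʳ; *-distribˡ-+; *-distribʳ-+; +-commutativeSemigroup
          ; module ≤-Reasoning)
  open import Algebra.Properties.CommutativeSemigroup +-commutativeSemigroup using (interchange)
  open import Relation.Nullary.Decidable using (T?)

  ∑ : ∀ {A : Set} → (A → ℕ) → List A → ℕ
  ∑ f xs = sum (map f xs)

  module _ {A : Set} where

    ∑-+ : ∀ (f g : A → ℕ) xs → ∑ (λ x → f x + g x) xs ≡ ∑ f xs + ∑ g xs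
    ∑-+ f g [] = refl
    ∑-+ f g (x ∷ xs) = trans (cong (f x + g x +_) (∑-+ f g xs)) (interchange (f x) (g x) (∑ f xs) (∑ g xs))

    ∑-*ˡ : ∀ c (f : A → ℕ) xs → ∑ (λ x → c * f x) xs ≡ c * ∑ f xs
    ∑-*ˡ c f [] = sym (*-zeroʳ c)
    ∑-*ˡ c f (x ∷ xs) = trans (cong (c * f x +_) (∑-*ˡ c f xs)) (sym (*-distribˡ-+ c (f x) _))

    ∑-*ʳ : ∀ c (f : A → ℕ) xs → ∑ (λ x → f x * c) xs ≡ ∑ f xs * c
    ∑-*ʳ c f [] = refl
    ∑-*ʳ c f (x ∷ xs) = trans (cong (f x * c +_) (∑-*ʳ c f xs)) (sym (*-distribʳ-+ c (f x) _))

    ∑-mono-≤ : ∀ {f g : A → ℕ} → (∀ x → f x ≤ g x) → ∀ xs → ∑ f xs ≤ ∑ g xs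
    ∑-mono-≤ f≤g [] = z≤n
    ∑-mono-≤ f≤g (x ∷ xs) = +-mono-≤ (f≤g x) (∑-mono-≤ f≤g xs)

    ∑-mono-< : ∀ {f g : A → ℕ} → (∀ x → f x ≤ g x) → ∀ {y xs} → y ∈ xs → f y < g y → ∑ f xs < ∑ g xs
    ∑-mono-< f≤g {xs = _ ∷ xs} (here refl) fy<gy = +-mono-<-≤ fy<gy (∑-mono-≤ f≤g xs)
    ∑-mono-< f≤g {xs = x ∷ _} (there y∈xs) fy<gy = +-mono-≤-< (f≤g x) (∑-mono-< f≤g y∈xs fy<gy)

  ∑-zero : ∀ {A : Set} (xs : List A) → ∑ (λ _ → 0) xs ≡ 0
  ∑-zero [] = refl
  ∑-zero (_ ∷ xs) = ∑-zero xs

  ∑-comm : ∀ {A B : Set} (f : A → B → ℕ) xs ys → ∑ (λ x → ∑ (f x) ys) xs ≡ ∑ (λ y → ∑ (λ x → f x y) xs) ys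
  ∑-comm f [] ys = sym (∑-zero ys)
  ∑-comm f (x ∷ xs) ys = trans (cong (∑ (f x) ys +_) (∑-comm f xs ys)) (sym (∑-+ (f x) _ ys))

  indicator : Bool → ℕ
  indicator true = 1
  indicator false = 0

  module _ {A : Set} where

    countB-∑ : ∀ (p : A → Bool) xs → countB p xs ≡ ∑ (indicator ∘ p) xs
    countB-∑ p [] = refl
    countB-∑ p (x ∷ xs) with p x
    ... | true = cong suc (countB-∑ p xs)
    ... | false = countB-∑ p xs

    countB-≡0 : ∀ {p : A → Bool} → (∀ x → ¬ T (p x)) → ∀ xs → countB p xs ≡ 0
    countB-≡0 {p} ¬p xs = cong length (filter-none (T? ∘ p) (All.universal ¬p xs))

    countB-pos : ∀ {p : A → Bool} {x xs} → x ∈ xs → T (p x) → 0 < countB p xs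
    countB-pos {p} x∈xs px = filter-some (T? ∘ p) (lose x∈xs px)

    countB-≤-length : ∀ (p : A → Bool) xs → countB p xs ≤ length xs
    countB-≤-length p = length-filter (T? ∘ p)

    countB-union : ∀ {p q r : A → Bool} → (∀ x → T (p x) → T (q x) ⊎ T (r x)) → ∀ xs →
                   countB p xs ≤ countB q xs + countB r xs
    countB-union {p} {q} {r} p⇒q∨r xs = begin
      countB p xs                                    ≡⟨ countB-∑ p xs ⟩
      ∑ (indicator ∘ p) xs                           ≤⟨ ∑-mono-≤ (λ x → indicator-∨ (p⇒q∨r x)) xs ⟩
      ∑ (λ x → indicator (q x) + indicator (r x)) xs ≡⟨ ∑-+ (indicator ∘ q) (indicator ∘ r) xs ⟩
      ∑ (indicator ∘ q) xs + ∑ (indicator ∘ r) xs    ≡⟨ cong₂ _+_ (countB-∑ q xs) (countB-∑ r xs) ⟨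
      countB q xs + countB r xs                      ∎
      where
      open ≤-Reasoning
      indicator-∨ : ∀ {a b c} → (T a → T b ⊎ T c) → indicator a ≤ indicator b + indicator c
      indicator-∨ {false} _ = z≤n
      indicator-∨ {true} {true} _ = s≤s z≤n
      indicator-∨ {true} {false} {true} _ = s≤s z≤n
      indicator-∨ {true} {false} {false} h with h _
      ... | inj₁ ()
      ... | inj₂ ()

    countB-mono-< : ∀ {p q : A → Bool} → (∀ x → T (p x) → T (q x)) → ∀ {y xs} → y ∈ xs →
                    T (q y) → ¬ T (p y) → countB p xs < countB q xs
    countB-mono-< {p} {q} p⇒q {y} {xs} y∈xs qy ¬py = begin-strict
      countB p xs          ≡⟨ countB-∑ p xs ⟩
      ∑ (indicator ∘ p) xs <⟨ ∑-mono-< (λ x → indicator-mono (p⇒q x)) y∈xs (indicator-< qy ¬py) ⟩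
      ∑ (indicator ∘ q) xs ≡⟨ countB-∑ q xs ⟨
      countB q xs          ∎
      where
      open ≤-Reasoning
      indicator-mono : ∀ {a b} → (T a → T b) → indicator a ≤ indicator b
      indicator-mono {false} _ = z≤n
      indicator-mono {true} {true} _ = s≤s z≤n
      indicator-mono {true} {false} h = ⊥-elim (h _)
      indicator-< : ∀ {a b} → T b → ¬ T a → indicator a < indicator b
      indicator-< {false} {true} _ _ = s≤s z≤n
      indicator-< {true} _ ¬a = ⊥-elim (¬a _)

open Sums

-- Each step of a strict increase adds an element of Fin n, so there is a
-- stationary step j ≤ n; from there on the chain is constant because each member
-- is determined monotonically by its predecessor.
module IncreasingChain {n : ℕ} (P : ℕ → Fin n → Bool)
  (P-increasing : ∀ k z → T (P k z) → T (P (suc k) z))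
  (P-suc-mono : ∀ {k l} → (∀ z → T (P k z) → T (P l z)) → ∀ z → T (P (suc k) z) → T (P (suc l) z))
  where

  open import Data.Fin.Properties using (all?; ¬∀⟶∃¬)
  open import Data.List.Properties using (length-tabulate)
  open import Data.Nat using (_+_; _∸_; _<_; _≤′_; ≤′-refl; ≤′-step)
  open import Data.Nat.Properties using (≤-refl; ≤-trans; ≤-total; ≤-<-trans; <-irrefl; ≤-reflexive; m≤n⇒m≤1+n; ≤⇒≤′; m∸n+n≡m)
  open import Relation.Nullary.Decidable using (T?; _→-dec_)

  infix 4 _⊑_
  _⊑_ : ℕ → ℕ → Set
  k ⊑ l = ∀ z → T (P k z) → T (P l z)

  size : ℕ → ℕ
  size k = countB (P k) (allFin n)

  ⊑-trans : ∀ {j k l} → j ⊑ k → k ⊑ l → j ⊑ l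
  ⊑-trans j⊑k k⊑l z = k⊑l z ∘ j⊑k z

  ≤′⇒⊑ : ∀ {k l} → k ≤′ l → k ⊑ l
  ≤′⇒⊑ ≤′-refl z t = t
  ≤′⇒⊑ (≤′-step k≤′l) = ⊑-trans (≤′⇒⊑ k≤′l) (P-increasing _)

  stable-forever : ∀ {j} → suc j ⊑ j → ∀ d → d + j ⊑ j
  stable-forever st zero z t = t
  stable-forever st (suc d) = ⊑-trans (P-suc-mono (stable-forever st d)) st

  size-grows : ∀ k → ¬ (suc k ⊑ k) → size k < size (suc k)
  size-grows k unstable with ¬∀⟶∃¬ n _ (λ z → T? (P (suc k) z) →-dec T? (P k z)) unstable
  ... | z , not-kept = countB-mono-< (P-increasing k) (∈-allFin z) (new not-kept) (λ t → not-kept (λ _ → t))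
    where
    new : ∀ {z} → ¬ (T (P (suc k) z) → T (P k z)) → T (P (suc k) z)
    new {z} h with P (suc k) z
    ... | true = _
    ... | false = h λ ()

  stable-or-large : ∀ k → (∃[ j ] j ≤ k × suc j ⊑ j) ⊎ suc k ≤ size (suc k)
  stable-or-large zero with all? (λ z → T? (P 1 z) →-dec T? (P 0 z))
  ... | yes st = inj₁ (0 , z≤n , st)
  ... | no unstable = inj₂ (≤-<-trans z≤n (size-grows 0 unstable))
  stable-or-large (suc k) with stable-or-large k | all? (λ z → T? (P (2 + k) z) →-dec T? (P (suc k) z))
  ... | inj₁ (j , j≤k , st) | _ = inj₁ (j , m≤n⇒m≤1+n j≤k , st)
  ... | inj₂ _ | yes st = inj₁ (suc k , ≤-refl , st)
  ... | inj₂ large | no unstable = inj₂ (≤-<-trans large (size-grows (suc k) unstable))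

  chain-stabilises : ∀ k → k ⊑ n
  chain-stabilises k with stable-or-large n
  ... | inj₂ large = ⊥-elim (<-irrefl refl (≤-trans large size≤n))
    where
    size≤n : size (suc n) ≤ n
    size≤n = ≤-trans (countB-≤-length _ (allFin n)) (≤-reflexive (length-tabulate (λ z → z)))
  ... | inj₁ (j , j≤n , st) with ≤-total k j
  ... | inj₁ k≤j = ≤′⇒⊑ (≤⇒≤′ (≤-trans k≤j j≤n))
  ... | inj₂ j≤k = ⊑-trans (subst (_⊑ j) (m∸n+n≡m j≤k) (stable-forever st (k ∸ j))) (≤′⇒⊑ (≤⇒≤′ j≤n))

module Connectivity where

  open import Data.Fin using (_≟_)
  open import Data.List.Membership.Propositional using (lose; find)
  open import Data.List.Membership.Propositional.Properties using (∈-++⁺ʳ; ∈-++⁻)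
  open import Data.List.Properties using (++-assoc; ++-identityʳ)
  open import Data.List.Relation.Binary.Subset.Propositional using (_⊆_)
  open import Data.List.Relation.Binary.Subset.Propositional.Properties using (xs⊆x∷xs; xs⊆xs++ys; ++⁺ʳ)
  open import Data.List.Relation.Binary.Sublist.Propositional as Sublist using (⊆-refl; _∷ʳ_) renaming (_⊆_ to _⊑_)
  open import Data.List.Relation.Unary.Any.Properties using (any⁺; any⁻)
  open import Data.Nat using (_+_)
  open import Data.Nat.Properties using (m≤n+m; n≤1+n)
  open import Relation.Nullary.Decidable using (⌊_⌋; toWitness; fromWitness)

  module _ {n : ℕ} where

    Link : List (Edge n) → Fin n → Fin n → Set
    Link F a b = (a , b) ∈ F ⊎ (b , a) ∈ F

    Link-sym : ∀ {F a b} → Link F a b → Link F b a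
    Link-sym (inj₁ ab) = inj₂ ab
    Link-sym (inj₂ ba) = inj₁ ba

    -- A record rather than T (reach F k i j), so that F, k, i, j can be inferred:
    -- T is not injective.
    record Reach (F : List (Edge n)) (k : ℕ) (i j : Fin n) : Set where
      constructor reached
      field reachable : T (reach F k i j)
    open Reach public

    T-≟-refl : ∀ (i : Fin n) → T ⌊ i ≟ i ⌋
    T-≟-refl i = fromWitness {a? = i ≟ i} refl

    module _ {F : List (Edge n)} where

      reach-zero : ∀ {i j} → Reach F 0 i j → i ≡ j
      reach-zero (reached t) = toWitness t

      reach-refl : ∀ k i → Reach F k i i
      reach-refl zero i = reached (T-≟-refl i)
      reach-refl (suc k) i = reached (from (T-∨ {⌊ i ≟ i ⌋}) (inj₁ (T-≟-refl i)))

      reach-∷ : ∀ {k i q j} → Link F i q → Reach F k q j → Reach F (suc k) i j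
      reach-∷ {k} {i} {q} {j} (inj₁ iq∈F) (reached t) =
        reached (from (T-∨ {⌊ i ≟ j ⌋}) (inj₂ (any⁺ _ (lose iq∈F
          (from (T-∨ {⌊ i ≟ i ⌋ ∧ reach F k q j}) (inj₁ (from (T-∧ {⌊ i ≟ i ⌋}) (T-≟-refl i , t))))))))
      reach-∷ {k} {i} {q} {j} (inj₂ qi∈F) (reached t) =
        reached (from (T-∨ {⌊ i ≟ j ⌋}) (inj₂ (any⁺ _ (lose qi∈F
          (from (T-∨ {⌊ q ≟ i ⌋ ∧ reach F k i j}) (inj₂ (from (T-∧ {⌊ i ≟ i ⌋}) (T-≟-refl i , t))))))))

      reach-suc⁻ : ∀ {k i j} → Reach F (suc k) i j → i ≡ j ⊎ ∃[ q ] Link F i q × Reach F k q j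
      reach-suc⁻ {k} {i} {j} (reached t) with to (T-∨ {⌊ i ≟ j ⌋}) t
      ... | inj₁ i≡j = inj₁ (toWitness i≡j)
      ... | inj₂ t′ with find (any⁻ _ F t′)
      ... | (a , b) , ab∈F , step with to (T-∨ {⌊ a ≟ i ⌋ ∧ reach F k b j}) step
      ... | inj₁ a≡i∧b↝j with to (T-∧ {⌊ a ≟ i ⌋}) a≡i∧b↝j
      ...   | a≡i , b↝j rewrite toWitness a≡i = inj₂ (b , inj₁ ab∈F , reached b↝j)
      reach-suc⁻ {k} {i} {j} (reached t) | inj₂ t′ | (a , b) , ab∈F , step | inj₂ b≡i∧a↝j
        with to (T-∧ {⌊ b ≟ i ⌋}) b≡i∧a↝j
      ...   | b≡i , a↝j rewrite toWitness b≡i = inj₂ (a , inj₂ ab∈F , reached a↝j)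

      reach-ind : (P : Fin n → Fin n → Set) → (∀ i → P i i) → (∀ {i q j} → Link F i q → P q j → P i j) →
                  ∀ k {i j} → Reach F k i j → P i j
      reach-ind P P-refl P-∷ zero r rewrite reach-zero r = P-refl _
      reach-ind P P-refl P-∷ (suc k) r with reach-suc⁻ r
      ... | inj₁ refl = P-refl _
      ... | inj₂ (q , iq , r′) = P-∷ iq (reach-ind P P-refl P-∷ k r′)

      reach-mono : ∀ {k l i j} → k ≤ l → Reach F k i j → Reach F l i j
      reach-mono {zero} {l} _ r rewrite reach-zero r = reach-refl l _
      reach-mono {suc k} (s≤s k≤l) r with reach-suc⁻ r
      ... | inj₁ refl = reach-refl _ _
      ... | inj₂ (q , iq , r′) = reach-∷ iq (reach-mono k≤l r′)

      reach-trans : ∀ {k l i j t} → Reach F k i j → Reach F l j t → Reach F (k + l) i t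
      reach-trans {zero} r s rewrite reach-zero r = s
      reach-trans {suc k} {l} r s with reach-suc⁻ r
      ... | inj₁ refl = reach-mono (m≤n+m l (suc k)) s
      ... | inj₂ (q , iq , r′) = reach-∷ iq (reach-trans r′ s)

      reach-suc-mono : ∀ {k l z j} → (∀ q → T (reach F k q j) → T (reach F l q j)) →
                       Reach F (suc k) z j → Reach F (suc l) z j
      reach-suc-mono k⊑l r with reach-suc⁻ r
      ... | inj₁ refl = reach-refl _ _
      ... | inj₂ (q , zq , reached t) = reach-∷ zq (reached (k⊑l q t))

      reach-saturates : ∀ {k i j} → Reach F k i j → Reach F n i j
      reach-saturates {k} {i} {j} r = reached (chain-stabilises k i (reachable r))
        where
        open IncreasingChain (λ k z → reach F k z j)
          (λ k z t → reachable (reach-mono (n≤1+n k) (reached t)))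
          (λ {k} {l} k⊑l z t → reachable (reach-suc-mono {k} {l} k⊑l (reached t)))
          using (chain-stabilises)

    Conn : List (Edge n) → Fin n → Fin n → Set
    Conn F = Reach F n

    module _ {F : List (Edge n)} where

      Conn-refl : ∀ i → Conn F i i
      Conn-refl = reach-refl n

      Conn-trans : ∀ {i j t} → Conn F i j → Conn F j t → Conn F i t
      Conn-trans r s = reach-saturates (reach-trans r s)

      Conn-link : ∀ {i j} → Link F i j → Conn F i j
      Conn-link ij = reach-saturates (reach-∷ ij (reach-refl 0 _))

      Conn-ind : (P : Fin n → Fin n → Set) → (∀ i → P i i) → (∀ {i q j} → Link F i q → P q j → P i j) →
                 ∀ {i j} → Conn F i j → P i j
      Conn-ind P P-refl P-∷ = reach-ind P P-refl P-∷ n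

      Conn-sym : ∀ {i j} → Conn F i j → Conn F j i
      Conn-sym = Conn-ind (λ i j → Conn F j i) Conn-refl (λ iq jq → Conn-trans jq (Conn-link (Link-sym iq)))

      ¬Conn⇒T-not : ∀ {i j} → ¬ Conn F i j → T (not (connIn F i j))
      ¬Conn⇒T-not {i} {j} ¬ij with connIn F i j in eq
      ... | true = ¬ij (reached (subst T (sym eq) _))
      ... | false = _

      T-not⇒¬Conn : ∀ {i j} → T (not (connIn F i j)) → ¬ Conn F i j
      T-not⇒¬Conn {i} {j} t (reached ij) with connIn F i j
      ... | true = t
      ... | false = ij

    Conn-via : ∀ {E F} → (∀ {a b} → (a , b) ∈ E → Conn F a b) → ∀ {i j} → Conn E i j → Conn F i j
    Conn-via {E} {F} E⊆ConnF = Conn-ind (Conn F) Conn-refl step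
      where
      step : ∀ {i q j} → Link E i q → Conn F q j → Conn F i j
      step (inj₁ iq∈E) = Conn-trans (E⊆ConnF iq∈E)
      step (inj₂ qi∈E) = Conn-trans (Conn-sym (E⊆ConnF qi∈E))

    Conn-mono : ∀ {E F} → E ⊆ F → ∀ {i j} → Conn E i j → Conn F i j
    Conn-mono E⊆F = Conn-via (Conn-link ∘ inj₁ ∘ E⊆F)

    Conn-[] : ∀ {i j} → Conn [] i j → i ≡ j
    Conn-[] = Conn-ind _≡_ (λ _ → refl) λ { (inj₁ ()) ; (inj₂ ()) }

    ConnVia : List (Edge n) → Fin n → Fin n → Fin n → Fin n → Set
    ConnVia L a b x y = Conn L x y ⊎ (Conn L x a × Conn L b y) ⊎ (Conn L x b × Conn L a y)

    Conn-snoc⁻ : ∀ {L a b x y} → Conn (L ++ [ (a , b) ]) x y → ConnVia L a b x y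
    Conn-snoc⁻ {L} {a} {b} = Conn-ind (ConnVia L a b) (inj₁ ∘ Conn-refl) step
      where
      prepend : ∀ {x q y} → Conn L x q → ConnVia L a b q y → ConnVia L a b x y
      prepend xq (inj₁ qy) = inj₁ (Conn-trans xq qy)
      prepend xq (inj₂ (inj₁ (qa , by))) = inj₂ (inj₁ (Conn-trans xq qa , by))
      prepend xq (inj₂ (inj₂ (qb , ay))) = inj₂ (inj₂ (Conn-trans xq qb , ay))
      cross-ab : ∀ {y} → ConnVia L a b b y → ConnVia L a b a y
      cross-ab (inj₁ by) = inj₂ (inj₁ (Conn-refl a , by))
      cross-ab (inj₂ (inj₁ (_ , by))) = inj₂ (inj₁ (Conn-refl a , by))
      cross-ab (inj₂ (inj₂ (_ , ay))) = inj₁ ay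
      cross-ba : ∀ {y} → ConnVia L a b a y → ConnVia L a b b y
      cross-ba (inj₁ ay) = inj₂ (inj₂ (Conn-refl b , ay))
      cross-ba (inj₂ (inj₁ (_ , by))) = inj₁ by
      cross-ba (inj₂ (inj₂ (_ , ay))) = inj₂ (inj₂ (Conn-refl b , ay))
      step : ∀ {x q y} → Link (L ++ [ (a , b) ]) x q → ConnVia L a b q y → ConnVia L a b x y
      step (inj₁ xq∈) with ∈-++⁻ L xq∈
      ... | inj₁ xq∈L = prepend (Conn-link (inj₁ xq∈L))
      ... | inj₂ (here refl) = cross-ab
      step (inj₂ qx∈) with ∈-++⁻ L qx∈
      ... | inj₁ qx∈L = prepend (Conn-link (inj₂ qx∈L))
      ... | inj₂ (here refl) = cross-ba

    acyclicAux-snoc : ∀ {a b} pre L → T (acyclicAux pre L) → ¬ Conn (pre ++ L) a b →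
                      T (acyclicAux pre (L ++ [ (a , b) ]))
    acyclicAux-snoc {a} {b} pre [] _ ¬ab = from (T-∧ {not (connIn (pre ++ []) a b)}) (¬Conn⇒T-not ¬ab , _)
    acyclicAux-snoc {a} {b} pre ((x , y) ∷ L) acyc ¬ab with to (T-∧ {not (connIn (pre ++ L) x y)}) acyc
    ... | xy-bridge , acyc′ = from (T-∧ {not (connIn (pre ++ (L ++ [ (a , b) ])) x y)})
                                (¬Conn⇒T-not ¬xy , acyclicAux-snoc (pre ++ [ (x , y) ]) L acyc′ ¬ab′)
      where
      ¬ab′ : ¬ Conn ((pre ++ [ (x , y) ]) ++ L) a b
      ¬ab′ = ¬ab ∘ subst (λ F → Conn F a b) (++-assoc pre [ (x , y) ] L)
      widen : ∀ {i j} → Conn (pre ++ L) i j → Conn (pre ++ (x , y) ∷ L) i j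
      widen = Conn-mono (++⁺ʳ pre (xs⊆x∷xs L (x , y)))
      xy : Conn (pre ++ (x , y) ∷ L) x y
      xy = Conn-link (inj₁ (∈-++⁺ʳ pre (here refl)))
      ¬xy : ¬ Conn (pre ++ (L ++ [ (a , b) ])) x y
      ¬xy c with Conn-snoc⁻ (subst (λ F → Conn F x y) (sym (++-assoc pre L [ (a , b) ])) c)
      ... | inj₁ xy′ = T-not⇒¬Conn xy-bridge xy′
      ... | inj₂ (inj₁ (xa , by)) = ¬ab (Conn-trans (Conn-sym (widen xa)) (Conn-trans xy (Conn-sym (widen by))))
      ... | inj₂ (inj₂ (xb , ay)) = ¬ab (Conn-trans (widen ay) (Conn-trans (Conn-sym xy) (widen xb)))

    data GrownForest : List (Edge n) → Set where
      empty : GrownForest []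
      add-bridge : ∀ {F a b} → T (acyclic F) → ¬ Conn F a b → GrownForest (F ++ [ (a , b) ])

    GrownForest-acyclic : ∀ {F} → GrownForest F → T (acyclic F)
    GrownForest-acyclic empty = _
    GrownForest-acyclic (add-bridge acyc ¬ab) = acyclicAux-snoc [] _ acyc ¬ab

    greedy : List (Edge n) → List (Edge n) → List (Edge n)
    greedy F [] = F
    greedy F ((a , b) ∷ es) = if connIn F a b then greedy F es else greedy (F ++ [ (a , b) ]) es

    greedy-extends : ∀ F es → ∃[ R ] R ⊑ es × greedy F es ≡ F ++ R
    greedy-extends F [] = [] , ⊆-refl , sym (++-identityʳ F)
    greedy-extends F ((a , b) ∷ es) with connIn F a b
    ... | true = let R , R⊑es , eq = greedy-extends F es in R , (a , b) ∷ʳ R⊑es , eq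
    ... | false = let R , R⊑es , eq = greedy-extends (F ++ [ (a , b) ]) es
                  in (a , b) ∷ R , refl Sublist.∷ R⊑es , trans eq (++-assoc F [ (a , b) ] R)

    greedy-⊇ : ∀ F es → F ⊆ greedy F es
    greedy-⊇ F es with greedy-extends F es
    ... | R , _ , eq rewrite eq = xs⊆xs++ys F R

    greedy-spans : ∀ {F a b} es → (a , b) ∈ es → Conn (greedy F es) a b
    greedy-spans {F} ((a , b) ∷ es) (here refl) with connIn F a b in eq
    ... | true = Conn-mono (greedy-⊇ F es) (reached (subst T (sym eq) _))
    ... | false = Conn-link (inj₁ (greedy-⊇ (F ++ [ (a , b) ]) es (∈-++⁺ʳ F (here refl))))
    greedy-spans {F} ((a , b) ∷ es) (there ab∈es) with connIn F a b
    ... | true = greedy-spans es ab∈es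
    ... | false = greedy-spans es ab∈es

    greedy-grown : ∀ {F} es → GrownForest F → GrownForest (greedy F es)
    greedy-grown [] g = g
    greedy-grown {F} ((a , b) ∷ es) g with connIn F a b in eq
    ... | true = greedy-grown es g
    ... | false = greedy-grown es (add-bridge (GrownForest-acyclic g) (λ ab → subst T eq (reachable ab)))

open Connectivity

module TwoForests where

  open import Data.List.Membership.Propositional.Properties using (∈-++⁺ʳ; ∈-++⁺ˡ; ∈-map⁺)
  open import Data.List.Relation.Binary.Sublist.Propositional as Sublist using (_∷ʳ_; ⊆-refl; ⊆-trans; lookup)
    renaming (_⊆_ to _⊑_)
  open import Data.List.Relation.Binary.Sublist.Propositional.Properties using () renaming (++⁺ʳ to ⊑-++⁺ʳ)
  open import Data.List.Relation.Unary.All as All using ()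
  open import Data.List.Relation.Unary.All.Properties using (all⁺; all⁻)
  import Data.Sum as Sum
  open import Function using (_⇔_; mk⇔)
  open import Relation.Nullary using (Dec)
  open import Relation.Nullary.Decidable using (T?; map′)

  ⊑⇒∈-sublists : ∀ {A : Set} {xs ys : List A} → xs ⊑ ys → xs ∈ sublists ys
  ⊑⇒∈-sublists Sublist.[] = here refl
  ⊑⇒∈-sublists (y ∷ʳ xs⊑ys) = ∈-++⁺ˡ (⊑⇒∈-sublists xs⊑ys)
  ⊑⇒∈-sublists {ys = y ∷ ys} (refl Sublist.∷ xs⊑ys) = ∈-++⁺ʳ (sublists ys) (∈-map⁺ (y ∷_) (⊑⇒∈-sublists xs⊑ys))

  module _ {n : ℕ} where

    Conn? : ∀ F (i j : Fin n) → Dec (Conn F i j)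
    Conn? F i j = map′ reached reachable (T? (connIn F i j))

    TwoForest : List (Edge n) → Fin n → Fin n → Set
    TwoForest F i j = T (acyclic F) × ¬ Conn F i j × (∀ k → Conn F i k ⊎ Conn F j k)

    isTwoForestSep⇔TwoForest : ∀ {F i j} → T (isTwoForestSep F i j) ⇔ TwoForest F i j
    isTwoForestSep⇔TwoForest {F} {i} {j} = mk⇔ to′ from′
      where
      covers : Fin n → Bool
      covers k = connIn F i k ∨ connIn F j k
      to′ : T (isTwoForestSep F i j) → TwoForest F i j
      to′ t with to (T-∧ {acyclic F}) t
      ... | acyc , t′ with to (T-∧ {not (connIn F i j)}) t′
      ... | ¬ij , all-covered = acyc , T-not⇒¬Conn ¬ij , λ k → Sum.map reached reached
            (to (T-∨ {connIn F i k}) (All.lookup (all⁺ covers (allFin n) all-covered) (∈-allFin k)))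
      from′ : TwoForest F i j → T (isTwoForestSep F i j)
      from′ (acyc , ¬ij , cover) = from (T-∧ {acyclic F}) (acyc , from (T-∧ {not (connIn F i j)}) (¬Conn⇒T-not ¬ij ,
        all⁻ covers {xs = allFin n} (All.tabulate λ {k} _ → from (T-∨ {connIn F i k}) (Sum.map reachable reachable (cover k)))))

    TwoForest-irrefl : ∀ {F i} → ¬ TwoForest F i i
    TwoForest-irrefl (_ , ¬ii , _) = ¬ii (Conn-refl _)

    TwoForest-split : ∀ {F i j} → TwoForest F i j → ∀ v → TwoForest F i v ⊎ TwoForest F j v
    TwoForest-split {F} {i} {j} (acyc , ¬ij , cover) v with Conn? F i v
    ... | yes iv = inj₂ (acyc , (λ jv → ¬ij (Conn-trans iv (Conn-sym jv))) , cover-jv)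
      where
      cover-jv : ∀ k → Conn F j k ⊎ Conn F v k
      cover-jv k with cover k
      ... | inj₁ ik = inj₂ (Conn-trans (Conn-sym iv) ik)
      ... | inj₂ jk = inj₁ jk
    ... | no ¬iv = inj₁ (acyc , ¬iv , cover-iv)
      where
      cover-iv : ∀ k → Conn F i k ⊎ Conn F v k
      cover-iv k with cover k | cover v
      ... | inj₁ ik | _ = inj₁ ik
      ... | inj₂ jk | inj₁ iv = ⊥-elim (¬iv iv)
      ... | inj₂ jk | inj₂ jv = inj₂ (Conn-trans (Conn-sym jv) jk)

    spanning-GrownForest⇒TwoForest : ∀ {F} {i j : Fin n} → GrownForest F → (∀ x y → Conn F x y) → i ≢ j →
      ∃[ F′ ] ∃[ a ] ∃[ b ] F′ ++ [ (a , b) ] ≡ F × TwoForest F′ a b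
    spanning-GrownForest⇒TwoForest {i = i} {j} empty spans i≢j = ⊥-elim (i≢j (Conn-[] (spans i j)))
    spanning-GrownForest⇒TwoForest (add-bridge {F′} {a} {b} acyc ¬ab) spans _ =
      F′ , a , b , refl , acyc , ¬ab , λ k → side (Conn-snoc⁻ (spans a k))
      where
      side : ∀ {k} → ConnVia F′ a b a k → Conn F′ a k ⊎ Conn F′ b k
      side (inj₁ ak) = inj₁ ak
      side (inj₂ (inj₁ (_ , bk))) = inj₂ bk
      side (inj₂ (inj₂ (_ , ak))) = inj₁ ak

    TwoForest-across-edge : (G : Graph n) → Connected G → ∀ {i j : Fin n} → i ≢ j →
      ∃[ F ] ∃[ a ] ∃[ b ] F ∈ sublists (edges G) × (a , b) ∈ edges G × TwoForest F a b
    TwoForest-across-edge G conn i≢j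
      with greedy-extends [] (edges G)
         | spanning-GrownForest⇒TwoForest (greedy-grown (edges G) empty)
             (λ x y → Conn-via (greedy-spans (edges G)) (reached (conn x y))) i≢j
    ... | R , R⊑edges , refl | F , a , b , F+ab≡R , forest =
      F , a , b , ⊑⇒∈-sublists (⊆-trans (⊑-++⁺ʳ [ (a , b) ] ⊆-refl) F+ab⊑edges) ,
      lookup F+ab⊑edges (∈-++⁺ʳ F (here refl)) , forest
      where
      F+ab⊑edges : F ++ [ (a , b) ] ⊑ edges G
      F+ab⊑edges = subst (_⊑ edges G) (sym F+ab≡R) R⊑edges

open TwoForests

module DegreesAndTwoForestMatrix where

  open import Data.Fin using (toℕ)
  open import Data.Fin.Properties using (toℕ-injective)
  open import Data.List using (concatMap)
  open import Data.List.Membership.Propositional.Properties using (∈-concatMap⁻)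
  open import Data.List.Properties using (length-++; map-cong)
  open import Data.List.Relation.Unary.Any using (satisfied)
  import Data.Nat as ℕ
  open import Data.Nat using (_+_; _*_; _<_)
  open import Data.Nat.Properties
    using (≤-trans; ≤-reflexive; ≤-antisym; <-asym; ≮⇒≥; m≤m+n; +-identityʳ; *-zeroʳ; *-mono-≤; *-monoˡ-≤; *-monoʳ-≤
          ; module ≤-Reasoning)
  open import Data.Nat.Tactic.RingSolver using (solve-∀)
  open import Data.Product using (proj₂)
  import Data.Sum as Sum
  open import Relation.Nullary.Decidable using (⌊_⌋)

  length-concatMap : ∀ {A B : Set} (f : A → List B) xs → length (concatMap f xs) ≡ ∑ (length ∘ f) xs
  length-concatMap f [] = refl
  length-concatMap f (x ∷ xs) = trans (length-++ (f x)) (cong (length (f x) +_) (length-concatMap f xs))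

  length-if-[] : ∀ {A : Set} c {y : A} → length (if c then [ y ] else []) ≡ indicator c
  length-if-[] true = refl
  length-if-[] false = refl

  ∈-if-[] : ∀ {A : Set} c {x y : A} → x ∈ (if c then [ y ] else []) → T c × x ≡ y
  ∈-if-[] true (here refl) = _ , refl

  module _ {A : Set} (w : A → ℕ) (s : A → A → ℕ) (v : A)
           (s-diag : ∀ i → s i i ≡ 0) (s-triangle : ∀ i j → s i j ≤ s i v + s j v) where

    quadratic-form-< : ∀ xs {i₀} → i₀ ∈ xs → 0 < w i₀ → 0 < s i₀ v →
      ∑ (λ i → ∑ (λ j → w i * s i j * w j) xs) xs < 2 * ∑ (λ i → w i * s i v) xs * ∑ w xs
    quadratic-form-< xs {i₀} i₀∈xs w₀>0 s₀>0 = begin-strict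
      ∑ (λ i → ∑ (f i) xs) xs
        <⟨ ∑-mono-< (λ i → ∑-mono-≤ (f≤g i) xs) i₀∈xs (∑-mono-< (f≤g i₀) i₀∈xs f<g-at-i₀) ⟩
      ∑ (λ i → ∑ (g i) xs) xs
        ≡⟨ cong sum (map-cong row xs) ⟩
      ∑ (λ i → w i * s i v * D + w i * E) xs
        ≡⟨ ∑-+ _ _ xs ⟩
      ∑ (λ i → w i * s i v * D) xs + ∑ (λ i → w i * E) xs
        ≡⟨ cong₂ _+_ (∑-*ʳ D (λ i → w i * s i v) xs) (∑-*ʳ E w xs) ⟩
      E * D + D * E
        ≡⟨ ab+ba≡2ab E D ⟩
      2 * E * D ∎
      where
      open ≤-Reasoning
      E D : ℕ
      E = ∑ (λ i → w i * s i v) xs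
      D = ∑ w xs
      f g : A → A → ℕ
      f i j = w i * s i j * w j
      g i j = w i * s i v * w j + w i * (w j * s j v)
      f≤g : ∀ i j → f i j ≤ g i j
      f≤g i j = ≤-trans (*-monoˡ-≤ (w j) (*-monoʳ-≤ (w i) (s-triangle i j)))
                        (≤-reflexive (expand (w i) (w j) (s i v) (s j v)))
        where
        expand : ∀ a b x y → a * (x + y) * b ≡ a * x * b + a * (b * y)
        expand = solve-∀
      f<g-at-i₀ : f i₀ i₀ < g i₀ i₀
      f<g-at-i₀ = begin-strict
        f i₀ i₀              ≡⟨ cong (λ x → w i₀ * x * w i₀) (s-diag i₀) ⟩
        w i₀ * 0 * w i₀      ≡⟨ cong (_* w i₀) (*-zeroʳ (w i₀)) ⟩
        0                    <⟨ *-mono-≤ (*-mono-≤ w₀>0 s₀>0) w₀>0 ⟩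
        w i₀ * s i₀ v * w i₀ ≤⟨ m≤m+n _ _ ⟩
        g i₀ i₀              ∎
      row : ∀ i → ∑ (g i) xs ≡ w i * s i v * D + w i * E
      row i = trans (∑-+ _ _ xs) (cong₂ _+_ (∑-*ˡ (w i * s i v) w xs) (∑-*ˡ (w i) (λ j → w j * s j v) xs))
      ab+ba≡2ab : ∀ a b → a * b + b * a ≡ 2 * a * b
      ab+ba≡2ab = solve-∀

  module _ {n : ℕ} (G : Graph n) where

    edges-adj : ∀ {a b} → (a , b) ∈ edges G → T (adj G a b)
    edges-adj ab∈ with satisfied (∈-concatMap⁻ _ {allFin n} ab∈)
    ... | i , ab∈row with satisfied (∈-concatMap⁻ _ {allFin n} ab∈row)
    ... | j , ab∈cell with ∈-if-[] (⌊ toℕ i ℕ.<? toℕ j ⌋ ∧ adj G i j) ab∈cell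
    ... | i<j∧ij , refl = proj₂ (to (T-∧ {⌊ toℕ i ℕ.<? toℕ j ⌋}) i<j∧ij)

    deg-pos : ∀ {a b} → T (adj G a b) → 0 < deg G a
    deg-pos {a} {b} = countB-pos {p = adj G a} (∈-allFin b)

    private
      upper : Fin n → Fin n → ℕ
      upper i j = indicator (⌊ toℕ i ℕ.<? toℕ j ⌋ ∧ adj G i j)

      numEdges-∑ : numEdges G ≡ ∑ (λ i → ∑ (upper i) (allFin n)) (allFin n)
      numEdges-∑ = trans (length-concatMap _ (allFin n)) (cong sum (map-cong row (allFin n)))
        where
        row : ∀ i → length (concatMap _ (allFin n)) ≡ ∑ (upper i) (allFin n)
        row i = trans (length-concatMap _ (allFin n))
                  (cong sum (map-cong (λ j → length-if-[] (⌊ toℕ i ℕ.<? toℕ j ⌋ ∧ adj G i j)) (allFin n)))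

      adj-upper : ∀ i j → indicator (adj G i j) ≡ upper i j + upper j i
      adj-upper i j with toℕ i ℕ.<? toℕ j | toℕ j ℕ.<? toℕ i
      ... | yes i<j | yes j<i = ⊥-elim (<-asym i<j j<i)
      ... | yes _ | no _ = sym (+-identityʳ _)
      ... | no _ | yes _ = cong indicator (Graph.sym G i j)
      ... | no i≮j | no j≮i with toℕ-injective (≤-antisym (≮⇒≥ j≮i) (≮⇒≥ i≮j))
      ... | refl rewrite Graph.irrefl G i = refl

    handshake : ∑ (deg G) (allFin n) ≡ 2 * numEdges G
    handshake = begin
      ∑ (deg G) (allFin n)
        ≡⟨ cong sum (map-cong (λ i → countB-∑ (adj G i) (allFin n)) (allFin n)) ⟩
      ∑ (λ i → ∑ (indicator ∘ adj G i) (allFin n)) (allFin n)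
        ≡⟨ cong sum (map-cong (λ i → trans (cong sum (map-cong (adj-upper i) (allFin n)))
                                           (∑-+ (upper i) (λ j → upper j i) (allFin n))) (allFin n)) ⟩
      ∑ (λ i → ∑ (upper i) (allFin n) + ∑ (λ j → upper j i) (allFin n)) (allFin n)
        ≡⟨ ∑-+ _ _ (allFin n) ⟩
      M + ∑ (λ i → ∑ (λ j → upper j i) (allFin n)) (allFin n)
        ≡⟨ cong (M +_) (∑-comm (λ i j → upper j i) (allFin n) (allFin n)) ⟩
      M + M
        ≡⟨ cong₂ _+_ numEdges-∑ (trans (+-identityʳ _) numEdges-∑) ⟨
      2 * numEdges G ∎
      where
      open ≡-Reasoning
      M : ℕ
      M = ∑ (λ i → ∑ (upper i) (allFin n)) (allFin n)

    twoForest-diag : ∀ i → twoForest G i i ≡ 0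
    twoForest-diag i =
      countB-≡0 (λ F → TwoForest-irrefl ∘ to (isTwoForestSep⇔TwoForest {F = F} {i = i} {j = i})) (sublists (edges G))

    twoForest-triangle : ∀ v i j → twoForest G i j ≤ twoForest G i v + twoForest G j v
    twoForest-triangle v i j = countB-union split (sublists (edges G))
      where
      split : ∀ F → T (isTwoForestSep F i j) → T (isTwoForestSep F i v) ⊎ T (isTwoForestSep F j v)
      split F t = Sum.map (from isTwoForestSep⇔TwoForest) (from isTwoForestSep⇔TwoForest)
                          (TwoForest-split (to (isTwoForestSep⇔TwoForest {F = F} {i = i} {j = j}) t) v)

    twoForest-pos : ∀ {F i j} → F ∈ sublists (edges G) → TwoForest F i j → 0 < twoForest G i j
    twoForest-pos {i = i} {j} F∈ forest =
      countB-pos {p = λ F → isTwoForestSep F i j} F∈ (from isTwoForestSep⇔TwoForest forest)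

    dSd<4mdSe : ∀ v {i₀} → 0 < deg G i₀ → 0 < twoForest G i₀ v → dSd G < 4 * numEdges G * dSe G v
    dSd<4mdSe v deg>0 s>0 = begin-strict
      dSd G
        <⟨ quadratic-form-< (deg G) (twoForest G) v twoForest-diag (twoForest-triangle v) (allFin n) (∈-allFin _) deg>0 s>0 ⟩
      2 * dSe G v * ∑ (deg G) (allFin n)
        ≡⟨ cong (2 * dSe G v *_) handshake ⟩
      2 * dSe G v * (2 * numEdges G)
        ≡⟨ reorder (dSe G v) (numEdges G) ⟩
      4 * numEdges G * dSe G v ∎
      where
      open ≤-Reasoning
      reorder : ∀ e m → 2 * e * (2 * m) ≡ 4 * m * e
      reorder = solve-∀

    separable-endpoint : Connected G → ∀ {i j : Fin n} → i ≢ j → ∀ v → ∃[ u ] 0 < deg G u × 0 < twoForest G u v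
    separable-endpoint conn i≢j v with TwoForest-across-edge G conn i≢j
    ... | F , a , b , F∈ , ab∈ , forest with TwoForest-split forest v
    ... | inj₁ av = a , deg-pos (edges-adj ab∈) , twoForest-pos F∈ av
    ... | inj₂ bv = b , deg-pos (subst T (Graph.sym G a b) (edges-adj ab∈)) , twoForest-pos F∈ bv

open DegreesAndTwoForestMatrix

module LambdaArithmetic where

  import Data.Nat as ℕ
  import Data.Nat.Properties as ℕ
  open import Data.Nat.Tactic.RingSolver using (solve-∀)
  open import Data.Integer using (+_; -_; _+_; _*_; _-_; _⊖_; _<_; +<+)
  open import Data.Integer.Properties using (pos-+; pos-*; m-n≡m⊖n; ≤-⊖)
  import Data.Integer.Tactic.RingSolver as ℤ-RingSolver

  pos-*³ : ∀ a b c → + (a ℕ.* b ℕ.* c) ≡ + a * + b * + c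
  pos-*³ a b c = trans (pos-* (a ℕ.* b) c) (cong (_* + c) (pos-* a b))

  lambda-pos : ∀ X m E τ → X ℕ.< 4 ℕ.* m ℕ.* E →
    + 0 < (- (+ 3 * + X)) + + 12 * + m * + E + + 8 * + m * + m * + τ + + 4 * + m * + τ - + 12 * + τ
  lambda-pos X zero E τ ()
  lambda-pos X m@(suc o) E τ X<4mE = subst (+ 0 <_) (sym λ≡A∸B) (+<+ (ℕ.m<n⇒0<n∸m B<A))
    where
    A B : ℕ
    A = 12 ℕ.* m ℕ.* E ℕ.+ (8 ℕ.* m ℕ.* m ℕ.* τ ℕ.+ 4 ℕ.* m ℕ.* τ)
    B = 3 ℕ.* X ℕ.+ 12 ℕ.* τ
    B<A : B ℕ.< A
    B<A = ℕ.+-mono-<-≤ (subst (3 ℕ.* X ℕ.<_) (three-fours m E) (ℕ.*-monoʳ-< 3 X<4mE))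
                        (subst (12 ℕ.* τ ℕ.≤_) (sym (expand o τ)) (ℕ.m≤m+n (12 ℕ.* τ) _))
      where
      three-fours : ∀ m E → 3 ℕ.* (4 ℕ.* m ℕ.* E) ≡ 12 ℕ.* m ℕ.* E
      three-fours = solve-∀
      expand : ∀ o τ → 8 ℕ.* suc o ℕ.* suc o ℕ.* τ ℕ.+ 4 ℕ.* suc o ℕ.* τ
                       ≡ 12 ℕ.* τ ℕ.+ (20 ℕ.* o ℕ.* τ ℕ.+ 8 ℕ.* o ℕ.* o ℕ.* τ)
      expand = solve-∀
    regroup : ∀ x m e t → (- (+ 3 * x)) + + 12 * m * e + + 8 * m * m * t + + 4 * m * t - + 12 * t
                        ≡ (+ 12 * m * e + (+ 8 * m * m * t + + 4 * m * t)) - (+ 3 * x + + 12 * t)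
    regroup = ℤ-RingSolver.solve-∀
    λ≡A∸B : (- (+ 3 * + X)) + + 12 * + m * + E + + 8 * + m * + m * + τ + + 4 * + m * + τ - + 12 * + τ
            ≡ + (A ℕ.∸ B)
    λ≡A∸B = begin
      (- (+ 3 * + X)) + + 12 * + m * + E + + 8 * + m * + m * + τ + + 4 * + m * + τ - + 12 * + τ
        ≡⟨ regroup (+ X) (+ m) (+ E) (+ τ) ⟩
      (+ 12 * + m * + E + (+ 8 * + m * + m * + τ + + 4 * + m * + τ)) - (+ 3 * + X + + 12 * + τ)
        ≡⟨ cong₂ _-_ +A +B ⟨
      + A - + B
        ≡⟨ m-n≡m⊖n A B ⟩
      A ⊖ B
        ≡⟨ ≤-⊖ (ℕ.<⇒≤ B<A) ⟩
      + (A ℕ.∸ B) ∎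
      where
      open ≡-Reasoning
      +A : + A ≡ + 12 * + m * + E + (+ 8 * + m * + m * + τ + + 4 * + m * + τ)
      +A = trans (pos-+ (12 ℕ.* m ℕ.* E) _) (cong₂ _+_ (pos-*³ 12 m E) (trans (pos-+ (8 ℕ.* m ℕ.* m ℕ.* τ) _)
             (cong₂ _+_ (trans (pos-* (8 ℕ.* m ℕ.* m) τ) (cong (_* + τ) (pos-*³ 8 m m))) (pos-*³ 4 m τ))))
      +B : + B ≡ + 3 * + X + + 12 * + τ
      +B = trans (pos-+ (3 ℕ.* X) _) (cong₂ _+_ (pos-* 3 X) (pos-* 12 τ))

open LambdaArithmetic

open import Data.Integer using (+_; _<_)

proposition3p2 : (n : ℕ) → 2 ≤ n → (G : Graph n) → Connected G →
    (v : Fin n) → + 0 < lambdaV G v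
proposition3p2 _ (s≤s (s≤s _)) G conn v =
  let _ , deg>0 , s>0 = separable-endpoint G conn {zero} {suc zero} (λ ()) v
  in lambda-pos (dSd G) (numEdges G) (dSe G v) (numSpanningTrees G) (dSd<4mdSe G v deg>0 s>0)
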